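{- For every bipartite graph $G=(U,V,E)$, the graph $G^\bullet$ is an $H_\infty$-graph.
   Context: For a bipartite graph $G$ with sides $U,V$ and edge set $E$, $G^\bullet$ is the graph with vertex set $U\uplus V\uplus E$ in which each of $U$, $V$, $E$ is a clique, there are no edges between $U$ and $V$, and each $e\in E$ is adjacent to every vertex of $U\cup V$ except the two endpoints of $e$. $H_\infty$ is the graph with a single vertex and two self-loops; its topological realisation is two circles meeting in exactly one point. An $H_\infty$-graph is the intersection graph of a family of connected subsets of this topological space (two subsets adjacent iff they intersect). -}

module Defs where

open import Data.Nat using (ℕ; suc)
open import Data.Fin using (Fin; zero; suc; inject₁; fromℕ)
open import Data.Bool using (Bool; T)
open import Data.Product using (Σ; ∃; _×_; _,_; proj₁; proj₂)
open import Data.Sum using (_⊎_; inj₁; inj₂)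
open import Data.Unit using (⊤)
open import Data.Empty using (⊥)
open import Relation.Nullary using (¬_)
open import Relation.Binary.PropositionalEquality using (_≡_; _≢_)
open import Function.Bundles using (_⇔_)

-- Subdivisions of H∞ (one vertex with two self-loops).
-- Sub p q : the centre vertex ctr, a left cycle
--   ctr – lft 0 – lft 1 – … – lft p – ctr        (length p+2)
-- and a right cycle
--   ctr – rgt 0 – rgt 1 – … – rgt q – ctr        (length q+2)
-- sharing only ctr.  Every subdivision of H∞ (in which each loop
-- is subdivided at least once) is of this form.

data Node (p q : ℕ) : Set where
  ctr : Node p q
  lft : Fin (suc p) → Node p q
  rgt : Fin (suc q) → Node p q

data Step {p q : ℕ} : Node p q → Node p q → Set where
  l-in  : Step ctr (lft zero)
  l-mid : (i : Fin p) → Step (lft (inject₁ i)) (lft (suc i))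
  l-out : Step (lft (fromℕ p)) ctr
  r-in  : Step ctr (rgt zero)
  r-mid : (i : Fin q) → Step (rgt (inject₁ i)) (rgt (suc i))
  r-out : Step (rgt (fromℕ q)) ctr

Link : {p q : ℕ} → Node p q → Node p q → Set
Link x y = Step x y ⊎ Step y x

data Walk {p q : ℕ} (S : Node p q → Bool) : Node p q → Node p q → Set where
  here : ∀ {x} → Walk S x x
  step : ∀ {x y z} → Link x y → T (S y) → Walk S y z → Walk S x z

Connected : {p q : ℕ} → (Node p q → Bool) → Set
Connected {p} {q} S =
  (∃ λ (x : Node p q) → T (S x)) ×
  (∀ x y → T (S x) → T (S y) → Walk S x y)

-- A graph (vertex type V, adjacency Adj, only used on distinct vertices)
-- is an H∞-graph: it is the intersection graph of nonempty connected
-- subgraphs of some subdivision of H∞.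
IsH∞Graph : (V : Set) → (V → V → Set) → Set
IsH∞Graph V Adj =
  Σ ℕ λ p → Σ ℕ λ q → Σ (V → Node p q → Bool) λ f →
    (∀ v → Connected (f v)) ×
    (∀ v w → v ≢ w → (Adj v w ⇔ (∃ λ (x : Node p q) → T (f v x) × T (f w x))))

-- Bipartite graphs G = (U, V, E) with U = Fin a, V = Fin b and edge
-- relation E : Fin a → Fin b → Bool, and the graph G•.

DotVertex : (a b : ℕ) → (Fin a → Fin b → Bool) → Set
DotVertex a b E =
  Fin a ⊎ (Fin b ⊎ Σ (Fin a × Fin b) (λ e → T (E (proj₁ e) (proj₂ e))))

DotAdj : (a b : ℕ) (E : Fin a → Fin b → Bool) →
         DotVertex a b E → DotVertex a b E → Set
DotAdj a b E (inj₁ u) (inj₁ u′) = ⊤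
DotAdj a b E (inj₁ u) (inj₂ (inj₁ v)) = ⊥
DotAdj a b E (inj₂ (inj₁ v)) (inj₁ u) = ⊥
DotAdj a b E (inj₂ (inj₁ v)) (inj₂ (inj₁ v′)) = ⊤
DotAdj a b E (inj₂ (inj₂ e)) (inj₂ (inj₂ e′)) = ⊤
DotAdj a b E (inj₁ u) (inj₂ (inj₂ ((u′ , v′) , _))) = u ≢ u′
DotAdj a b E (inj₂ (inj₂ ((u′ , v′) , _))) (inj₁ u) = u ≢ u′
DotAdj a b E (inj₂ (inj₁ v)) (inj₂ (inj₂ ((u′ , v′) , _))) = v ≢ v′
DotAdj a b E (inj₂ (inj₂ ((u′ , v′) , _))) (inj₂ (inj₁ v)) = v ≢ v′

{-# OPTIONS --safe #-}
-- Subdivide the left loop of H∞ into a path 0, …, 2a whose ends are joined to the centre, and the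
-- right loop likewise into 0, …, 2b.  A vertex u ∈ U becomes the interval [u, u + a] of the left
-- path, v ∈ V the interval [v, v + b] of the right path, and an edge (u, v) the centre together with
-- the complements of these two intervals, which is connected through the centre.  The intervals on
-- one path all contain its midpoint, the two paths share nothing, and every edge set contains the
-- centre.  Finally, intervals of equal length are never strictly nested, so [u′, u′ + a] meets the
-- complement of [u, u + a] exactly when u′ ≠ u.
module Submission where

open import Defs
open import Data.Nat using (ℕ; suc; _+_; _≤_; _<_; _≤?_; _<?_; z≤n; s≤s)
open import Data.Nat.Properties
  using (≤-refl; ≤-trans; <⇒≤; <⇒≱; ≤-<-trans; <-≤-trans; m≤m+n; m≤n+m; +-monoˡ-≤; +-monoˡ-<; <-cmp)
open import Data.Fin as Fin using (Fin; zero; suc; toℕ; inject₁; fromℕ; fromℕ<)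
open import Data.Fin.Properties using (toℕ-fromℕ<; toℕ-injective; toℕ<n; ≤fromℕ)
open import Data.Bool using (Bool; true; false; T)
open import Data.Product using (∃; _×_; _,_; proj₂; map₂; swap)
open import Data.Sum as Sum using (_⊎_; inj₁; inj₂)
open import Data.Unit using (tt)
open import Data.Empty using (⊥-elim)
open import Function using (_∘_; const)
open import Function.Bundles using (_⇔_; mk⇔; Equivalence)
open import Relation.Nullary using (¬_; Dec)
open import Relation.Nullary.Decidable using (⌊_⌋; _×-dec_; _⊎-dec_; toWitness; fromWitness)
open import Relation.Binary using (tri<; tri≈; tri>)
open import Relation.Binary.PropositionalEquality using (_≡_; _≢_; refl)

module _ {p q : ℕ} {S : Node p q → Bool} where

  infixr 5 _++ʷ_
  _++ʷ_ : ∀ {x y z} → Walk S x y → Walk S y z → Walk S x z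
  here         ++ʷ w′ = w′
  step l y∈S w ++ʷ w′ = step l y∈S (w ++ʷ w′)

  reverseʷ : ∀ {x y} → T (S x) → Walk S x y → Walk S y x
  reverseʷ x∈S here           = here
  reverseʷ x∈S (step l y∈S w) = reverseʷ y∈S w ++ʷ step (Sum.swap l) x∈S here

  connected-from : (o : Node p q) → T (S o) → (∀ x → T (S x) → Walk S o x) → Connected S
  connected-from o o∈S walk = (o , o∈S) , λ x y x∈S y∈S → reverseʷ o∈S (walk x x∈S) ++ʷ walk y y∈S

  path-walk : ∀ {n} (node : Fin (suc n) → Node p q) →
              (∀ i → Link (node (inject₁ i)) (node (suc i))) →
              ∀ i j → i Fin.≤ j → (∀ k → i Fin.≤ k → k Fin.≤ j → T (S (node k))) →
              Walk S (node i) (node j)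
  path-walk node edge zero zero _ _ = here
  path-walk {suc n} node edge zero (suc j) _ inS =
    step (edge zero) (inS (suc zero) z≤n (s≤s z≤n))
      (path-walk (node ∘ suc) (edge ∘ suc) zero j z≤n λ k _ k≤j → inS (suc k) z≤n (s≤s k≤j))
  path-walk {suc n} node edge (suc i) (suc j) (s≤s i≤j) inS =
    path-walk (node ∘ suc) (edge ∘ suc) i j i≤j λ k i≤k k≤j → inS (suc k) (s≤s i≤k) (s≤s k≤j)

index-of : ∀ {n b} → n ≤ b → ∃ λ (k : Fin (suc b)) → toℕ k ≡ n
index-of n≤b = fromℕ< (s≤s n≤b) , toℕ-fromℕ< (s≤s n≤b)

Within : ℕ → ℕ → ℕ → Set
Within i m n = i ≤ n × n ≤ i + m

Beyond : ℕ → ℕ → ℕ → Set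
Beyond i m n = n < i ⊎ i + m < n

within? : ∀ i m n → Dec (Within i m n)
within? i m n = i ≤? n ×-dec n ≤? i + m

beyond? : ∀ i m n → Dec (Beyond i m n)
beyond? i m n = n <? i ⊎-dec i + m <? n

within⇒¬beyond : ∀ {i m n} → Within i m n → ¬ Beyond i m n
within⇒¬beyond (i≤n , _)   (inj₁ n<i)   = <⇒≱ n<i i≤n
within⇒¬beyond (_ , n≤i+m) (inj₂ i+m<n) = <⇒≱ i+m<n n≤i+m

≢⇒within-beyond : ∀ {i j} m → i ≢ j → ∃ λ n → Within i m n × Beyond j m n
≢⇒within-beyond {i} {j} m i≢j with <-cmp i j
... | tri< i<j _ _ = i , (≤-refl , m≤m+n i m) , inj₁ i<j
... | tri≈ _ i≡j _ = ⊥-elim (i≢j i≡j)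
... | tri> _ _ j<i = i + m , (m≤m+n i m , ≤-refl) , inj₂ (+-monoˡ-< m j<i)

module Arm {p q n : ℕ} (node : Fin (suc n) → Node p q)
           (edge : ∀ i → Link (node (inject₁ i)) (node (suc i)))
           (enter : Link ctr (node zero)) (leave : Link (node (fromℕ n)) ctr)
           {S : Node p q → Bool} where

  within-walk : ∀ {m} k₀ → (∀ k → Within (toℕ k₀) m (toℕ k) → T (S (node k))) →
                ∀ k → Within (toℕ k₀) m (toℕ k) → Walk S (node k₀) (node k)
  within-walk k₀ inS k (k₀≤k , k≤k₀+m) =
    path-walk node edge k₀ k k₀≤k λ k′ k₀≤k′ k′≤k → inS k′ (k₀≤k′ , ≤-trans k′≤k k≤k₀+m)

  beyond-walk : ∀ {i m} → T (S ctr) → (∀ k → Beyond i m (toℕ k) → T (S (node k))) →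
                ∀ k → Beyond i m (toℕ k) → Walk S ctr (node k)
  beyond-walk ctr∈S inS k (inj₁ k<i) =
    step enter (inS zero (inj₁ (≤-<-trans z≤n k<i)))
      (path-walk node edge zero k z≤n λ k′ _ k′≤k → inS k′ (inj₁ (≤-<-trans k′≤k k<i)))
  beyond-walk ctr∈S inS k (inj₂ i+m<k) =
    reverseʷ (inS k (inj₂ i+m<k))
      (path-walk node edge k (fromℕ n) (≤fromℕ k)
         (λ k′ k≤k′ _ → inS k′ (inj₂ (<-≤-trans i+m<k k≤k′)))
       ++ʷ step leave ctr∈S here)

inside : ℕ → ℕ → ℕ → Bool
inside i m n = ⌊ within? i m n ⌋

outside : ℕ → ℕ → ℕ → Bool
outside i m n = ⌊ beyond? i m n ⌋

module _ {p q : ℕ} where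

  region : Bool → (ℕ → Bool) → (ℕ → Bool) → Node p q → Bool
  region c L R ctr     = c
  region c L R (lft k) = L (toℕ k)
  region c L R (rgt k) = R (toℕ k)

  Meet : (Node p q → Bool) → (Node p q → Bool) → Set
  Meet S S′ = ∃ λ x → T (S x) × T (S′ x)

  Meet-sym : ∀ {S S′} → Meet S S′ → Meet S′ S
  Meet-sym = map₂ swap

  Meet-sym-⇔ : ∀ {ℓ} {A : Set ℓ} {S S′} → A ⇔ Meet S S′ → A ⇔ Meet S′ S
  Meet-sym-⇔ A⇔M = mk⇔ (Meet-sym ∘ Equivalence.to A⇔M) (Equivalence.from A⇔M ∘ Meet-sym)

  private
    module Left  = Arm {p} {q} lft (λ i → inj₁ (l-mid i)) (inj₁ l-in) (inj₁ l-out)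
    module Right = Arm {p} {q} rgt (λ i → inj₁ (r-mid i)) (inj₁ r-in) (inj₁ r-out)

  interval-connectedˡ : ∀ {i} m → i ≤ p → Connected (region false (inside i m) (const false))
  interval-connectedˡ m i≤p with index-of i≤p
  ... | k₀ , refl = connected-from (lft k₀) (fromWitness (≤-refl , m≤m+n _ m)) λ where
    (lft k) k∈ → Left.within-walk k₀ (λ _ → fromWitness) k (toWitness k∈)
    ctr ()
    (rgt k) ()

  interval-connectedʳ : ∀ {i} m → i ≤ q → Connected (region false (const false) (inside i m))
  interval-connectedʳ m i≤q with index-of i≤q
  ... | k₀ , refl = connected-from (rgt k₀) (fromWitness (≤-refl , m≤m+n _ m)) λ where
    (rgt k) k∈ → Right.within-walk k₀ (λ _ → fromWitness) k (toWitness k∈)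
    ctr ()
    (lft k) ()

  cointervals-connected : ∀ i m j m′ → Connected (region true (outside i m) (outside j m′))
  cointervals-connected i m j m′ = connected-from ctr tt λ where
    ctr     _  → here
    (lft k) k∈ → Left.beyond-walk tt (λ _ → fromWitness) k (toWitness k∈)
    (rgt k) k∈ → Right.beyond-walk tt (λ _ → fromWitness) k (toWitness k∈)

  sides-disjoint : ∀ {L R} → ¬ Meet (region false L (const false)) (region false (const false) R)
  sides-disjoint (ctr   , () , _)
  sides-disjoint (lft _ , _ , ())
  sides-disjoint (rgt _ , () , _)

  intervals-meetˡ : ∀ {i j m R R′} → i ≤ m → j ≤ m → m ≤ p →
                    Meet (region false (inside i m) R) (region false (inside j m) R′)
  intervals-meetˡ {i} {j} i≤m j≤m m≤p with index-of m≤p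
  ... | k , refl = lft k , fromWitness (i≤m , m≤n+m _ i) , fromWitness (j≤m , m≤n+m _ j)

  intervals-meetʳ : ∀ {i j m L L′} → i ≤ m → j ≤ m → m ≤ q →
                    Meet (region false L (inside i m)) (region false L′ (inside j m))
  intervals-meetʳ {i} {j} i≤m j≤m m≤q with index-of m≤q
  ... | k , refl = rgt k , fromWitness (i≤m , m≤n+m _ i) , fromWitness (j≤m , m≤n+m _ j)

  interval-meets-cointervalˡ : ∀ {i j m R} → i + m ≤ p → i ≢ j →
    Meet (region false (inside i m) (const false)) (region true (outside j m) R)
  interval-meets-cointervalˡ {m = m} i+m≤p i≢j with ≢⇒within-beyond m i≢j
  ... | n , n∈ , n∉ with index-of (≤-trans (proj₂ n∈) i+m≤p)
  ... | k , refl = lft k , fromWitness n∈ , fromWitness n∉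

  interval-meets-cointervalʳ : ∀ {i j m L} → i + m ≤ q → i ≢ j →
    Meet (region false (const false) (inside i m)) (region true L (outside j m))
  interval-meets-cointervalʳ {m = m} i+m≤q i≢j with ≢⇒within-beyond m i≢j
  ... | n , n∈ , n∉ with index-of (≤-trans (proj₂ n∈) i+m≤q)
  ... | k , refl = rgt k , fromWitness n∈ , fromWitness n∉

  interval-avoids-cointervalˡ : ∀ {i m c R} →
    ¬ Meet (region false (inside i m) (const false)) (region c (outside i m) R)
  interval-avoids-cointervalˡ (lft k , k∈ , k∉) = within⇒¬beyond (toWitness k∈) (toWitness k∉)
  interval-avoids-cointervalˡ (ctr   , () , _)
  interval-avoids-cointervalˡ (rgt _ , () , _)

  interval-avoids-cointervalʳ : ∀ {i m c L} →
    ¬ Meet (region false (const false) (inside i m)) (region c L (outside i m))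
  interval-avoids-cointervalʳ (rgt k , k∈ , k∉) = within⇒¬beyond (toWitness k∈) (toWitness k∉)
  interval-avoids-cointervalʳ (ctr   , () , _)
  interval-avoids-cointervalʳ (lft _ , () , _)

module Representation (a b : ℕ) (E : Fin a → Fin b → Bool) where

  model : DotVertex a b E → Node (a + a) (b + b) → Bool
  model (inj₁ u)                    = region false (inside (toℕ u) a) (const false)
  model (inj₂ (inj₁ v))             = region false (const false) (inside (toℕ v) b)
  model (inj₂ (inj₂ ((u , v) , _))) = region true (outside (toℕ u) a) (outside (toℕ v) b)

  private
    start≤ : ∀ {n} (i : Fin n) → toℕ i ≤ n
    start≤ i = <⇒≤ (toℕ<n i)

    end≤ : ∀ {n} (i : Fin n) → toℕ i + n ≤ n + n
    end≤ {n} i = +-monoˡ-≤ n (start≤ i)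

  model-connected : ∀ x → Connected (model x)
  model-connected (inj₁ u)                    = interval-connectedˡ a (≤-trans (m≤m+n _ a) (end≤ u))
  model-connected (inj₂ (inj₁ v))             = interval-connectedʳ b (≤-trans (m≤m+n _ b) (end≤ v))
  model-connected (inj₂ (inj₂ ((u , v) , _))) = cointervals-connected (toℕ u) a (toℕ v) b

  U-E-adjacency : ∀ (u u′ : Fin a) {R} →
                  u ≢ u′ ⇔ Meet (model (inj₁ u)) (region true (outside (toℕ u′) a) R)
  U-E-adjacency u u′ = mk⇔ (interval-meets-cointervalˡ (end≤ u) ∘ (_∘ toℕ-injective))
                           λ { M refl → interval-avoids-cointervalˡ M }

  V-E-adjacency : ∀ (v v′ : Fin b) {L} →
                  v ≢ v′ ⇔ Meet (model (inj₂ (inj₁ v))) (region true L (outside (toℕ v′) b))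
  V-E-adjacency v v′ = mk⇔ (interval-meets-cointervalʳ (end≤ v) ∘ (_∘ toℕ-injective))
                           λ { M refl → interval-avoids-cointervalʳ M }

  model-adjacency : ∀ x y → DotAdj a b E x y ⇔ Meet (model x) (model y)
  model-adjacency (inj₁ u) (inj₁ u′) =
    mk⇔ (λ _ → intervals-meetˡ (start≤ u) (start≤ u′) (m≤m+n a a)) (λ _ → tt)
  model-adjacency (inj₂ (inj₁ v)) (inj₂ (inj₁ v′)) =
    mk⇔ (λ _ → intervals-meetʳ (start≤ v) (start≤ v′) (m≤m+n b b)) (λ _ → tt)
  model-adjacency (inj₂ (inj₂ _)) (inj₂ (inj₂ _)) = mk⇔ (λ _ → ctr , tt , tt) (λ _ → tt)
  model-adjacency (inj₁ u) (inj₂ (inj₁ v)) = mk⇔ ⊥-elim sides-disjoint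
  model-adjacency (inj₂ (inj₁ v)) (inj₁ u) = Meet-sym-⇔ (mk⇔ ⊥-elim sides-disjoint)
  model-adjacency (inj₁ u) (inj₂ (inj₂ ((u′ , _) , _))) = U-E-adjacency u u′
  model-adjacency (inj₂ (inj₂ ((u′ , _) , _))) (inj₁ u) = Meet-sym-⇔ (U-E-adjacency u u′)
  model-adjacency (inj₂ (inj₁ v)) (inj₂ (inj₂ ((_ , v′) , _))) = V-E-adjacency v v′
  model-adjacency (inj₂ (inj₂ ((_ , v′) , _))) (inj₂ (inj₁ v)) = Meet-sym-⇔ (V-E-adjacency v v′)

fact35 : (a b : ℕ) (E : Fin a → Fin b → Bool) →
    IsH∞Graph (DotVertex a b E) (DotAdj a b E)
fact35 a b E = a + a , b + b , model , model-connected , λ x y _ → model-adjacency x y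
  where open Representation a b E
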